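{- Let $n\ge1$, $x_0=(x_1\cdots x_n)^{ -1}$, $f=1-t(x_0+\dots+x_n)$. Let $\mathbf{U}\in\mathbb{Z}_{\ge0}^{n+1}$ with $|\mathbf{U}|<n$, let $\mathbf{V}=(V_0,\dots,V_n)\in\mathbb{Z}_{\ge0}^{n+1}$ with $\min_iV_i=0$, and let $N$ be a sufficiently large positive integer. Then the coefficient of the monomial $\mathbf{x}^{N\mathbf{V}}=x_0^{NV_0}x_1^{NV_1}\cdots x_n^{NV_n}$ in the formal expansion of $\eta_{\mathbf{U}}$ is divisible by $t^{N|\mathbf{V}|}$, and its quotient by $t^{N|\mathbf{V}|}$, evaluated at $t=0$, equals \[ \binom{N|\mathbf{V}|}{NV_0,NV_1,\dots,NV_n}\prod_{i=0}^n(NV_i)^{U_i}, \] where $(NV_i)^{U_i}$ is read as $1$ when $U_i=V_i=0$.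
   Context: For $\mathbf{K}\in\mathbb{Z}_{\ge0}^{n+1}$, $\mathbf{x}^{\mathbf{K}}=x_0^{K_0}\cdots x_n^{K_n}$ (a Laurent monomial in $x_1,\dots,x_n$), $|\mathbf{K}|=\sum K_i$, and $\omega_{\mathbf{K}}=|\mathbf{K}|!\,t^{|\mathbf{K}|}\mathbf{x}^{\mathbf{K}}/f^{|\mathbf{K}|+1}$. With $S(m,k)$ the Stirling numbers of the second kind (defined by $x^m=\sum_{k=0}^mS(m,k)[x]_k$, $[x]_k=x(x-1)\cdots(x-k+1)$), set \[ \eta_{\mathbf{U}}=\sum_{K_0=0}^{U_0}\cdots\sum_{K_n=0}^{U_n}S(U_0,K_0)\cdots S(U_n,K_n)\,\omega_{(K_0,\dots,K_n)}. \] The formal expansion of $\omega_{\mathbf{K}}$ is the Laurent series in $x_1,\dots,x_n$ with coefficients in $\mathbb{Z}[[t]]$ obtained from $\frac{1}{f^{m+1}}=\sum_{k\ge0}\binom{m+k}{k}t^k(x_0+\dots+x_n)^k$ (each coefficient being a finite sum of monomials in $t$ for every fixed power of $t$); the expansion of $\eta_{\mathbf{U}}$ is the corresponding linear combination. Multinomial coefficients are $\binom{\sum r_i}{r_0,\dots,r_n}=\frac{(\sum r_i)!}{\prod r_i!}$. -}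

module Defs where

open import Data.Nat using (ℕ; zero; suc; _+_; _*_; _∸_; _^_; _≤_; _<_; _≤ᵇ_; NonZero; _!; _/_)
open import Data.Nat.Properties using (_!≢0; m*n≢0)
open import Data.Nat.Combinatorics using (_C_)
open import Data.Integer using (ℤ; _-_; +_)
import Data.Integer as ℤ
open import Data.Bool using (if_then_else_)
open import Data.List using (List; []; _∷_; [_]; concatMap; upTo; map; filter)
open import Data.Nat.ListAction using (sum)
open import Data.Vec using (Vec; []; _∷_; zipWith; foldr; head; tail)
import Data.Vec as Vec
import Data.Vec.Properties as VecP
open import Relation.Nullary using (Dec; does)
open import Relation.Binary.PropositionalEquality using (_≡_)

vsum : ∀ {m} → Vec ℕ m → ℕ
vsum = Vec.sum

vprod : ∀ {m} → Vec ℕ m → ℕ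
vprod = foldr _ _*_ 1

S : ℕ → ℕ → ℕ
S zero    zero    = 1
S zero    (suc k) = 0
S (suc m) zero    = 0
S (suc m) (suc k) = suc k * S m (suc k) + S m k

factProd : ∀ {m} → Vec ℕ m → ℕ
factProd []       = 1
factProd (r ∷ rs) = r ! * factProd rs

factProd≢0 : ∀ {m} (r : Vec ℕ m) → NonZero (factProd r)
factProd≢0 []       = _
factProd≢0 (r ∷ rs) = m*n≢0 (r !) (factProd rs) {{r !≢0}} {{factProd≢0 rs}}

multinomial : ∀ {m} → Vec ℕ m → ℕ
multinomial r = (vsum r ! / factProd r) {{factProd≢0 r}}

compositions : (m k : ℕ) → List (Vec ℕ m)
compositions zero    zero    = [ [] ]
compositions zero    (suc k) = []
compositions (suc m) k =
  concatMap (λ i → map (i ∷_) (compositions m (k ∸ i))) (upTo (suc k))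

box : ∀ {m} → Vec ℕ m → List (Vec ℕ m)
box []       = [ [] ]
box (u ∷ us) = concatMap (λ i → map (i ∷_) (box us)) (upTo (suc u))

-- The Laurent monomial x^E = x_0^{E_0} x_1^{E_1} ... x_n^{E_n} with
-- x_0 = (x_1 ... x_n)^{-1}, recorded by its exponent vector in x_1..x_n:
-- exponent of x_i is E_i - E_0.
laurent : ∀ {n} → Vec ℕ (suc n) → Vec ℤ n
laurent (e₀ ∷ es) = Vec.map (λ e → + e - + e₀) es

_≟ᴸ_ : ∀ {n} → (a b : Vec ℤ n) → Dec (a ≡ b)
_≟ᴸ_ = VecP.≡-dec ℤ._≟_

-- Coefficient of x^K (x_0+...+x_n)^k t^{|K|+k} -type contributions:
-- the coefficient of t^j · (Laurent monomial m) in the formal expansion of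
--   ω_K = |K|! t^{|K|} x^K Σ_k C(|K|+k,k) t^k (x_0+...+x_n)^k
--       = |K|! Σ_k Σ_{|r|=k} C(|K|+k,k) multinomial(r) t^{|K|+k} x^{K+r}.
omegaCoeff : ∀ {n} → Vec ℕ (suc n) → Vec ℤ n → ℕ → ℕ
omegaCoeff {n} K m j =
  if vsum K ≤ᵇ j
  then sum (map (λ r → vsum K ! * ((vsum K + k) C k) * multinomial r)
                (filter (λ r → laurent (zipWith _+_ K r) ≟ᴸ m)
                        (compositions (suc n) k)))
  else 0
  where k = j ∸ vsum K

-- coefficient of t^j · (Laurent monomial m) in the formal expansion of
--   η_U = Σ_{K ≤ U} Π_i S(U_i,K_i) ω_K
etaCoeff : ∀ {n} → Vec ℕ (suc n) → Vec ℤ n → ℕ → ℕ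
etaCoeff U m j =
  sum (map (λ K → vprod (zipWith S U K) * omegaCoeff K m j) (box U))

{-# OPTIONS --safe #-}
-- Two exponent vectors give the same Laurent monomial iff they differ by a multiple of
-- (1,…,1).  As N·V has a zero entry, it has the least degree in its class, so in
-- ω_K = |K|! Σ_r C(|K|+|r|,|r|) multinomial(r) t^(|K|+|r|) x^(K+r) the monomial x^(NV)
-- occurs in no t-degree below N|V|, and in degree N|V| only for r = NV − K.  That term is
-- multinomial(NV) · Π_i (NV_i)_(K_i) with falling factorials (zero unless K ≤ NV), and
-- Σ_(K ≤ U) Π_i S(U_i,K_i) (x_i)_(K_i) = Π_i x_i^(U_i) turns the sum over K into
-- multinomial(NV) · Π_i (NV_i)^(U_i).
module Submission where

open import Defs
open import Data.Nat using (ℕ; zero; suc; _+_; _*_; _∸_; _^_; _≤_; _<_; _!; z≤n; s≤s)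
open import Data.Nat.Properties
open import Data.Nat.Combinatorics
  using (_C_; _P_; nCk≡n!/k![n-k]!; k![n∸k]!∣n!; nPk≡n!/[n∸k]!; k>n⇒nPk≡0)
open import Data.Nat.Combinatorics.Base using (_P′_)
open import Data.Nat.DivMod using (m/n*n≡m)
open import Data.Nat.Divisibility using (_∣_; ∣-refl; ∣-trans; *-monoʳ-∣; m≤n⇒m!∣n!)
open import Data.Nat.ListAction using (sum)
open import Data.Nat.ListAction.Properties using (sum-++)
open import Data.Bool using (true; false; if_then_else_)
open import Data.List as List using (List; []; _∷_; _++_; concatMap; upTo; applyUpTo; filter)
import Data.List.Properties as List
open import Data.Vec as Vec using (Vec; []; _∷_; zipWith; head)
import Data.Vec.Properties as Vec
open import Data.Vec.Relation.Unary.Any as Any using (Any; here; there)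
open import Data.Vec.Relation.Unary.Any.Properties using (map⁺)
open import Data.Vec.Relation.Binary.Pointwise.Inductive as Pointwise using (Pointwise; []; _∷_)
open import Data.Integer using (ℤ)
import Data.Integer as ℤ
import Data.Integer.Properties as ℤ
import Data.Integer.Tactic.RingSolver as ℤ
open import Data.Product using (Σ; _×_; _,_)
open import Data.Empty using (⊥-elim)
open import Function using (_∘_)
open import Relation.Nullary using (Dec; yes; no; does; ¬_)
open import Relation.Unary using (Decidable)
open import Relation.Binary.PropositionalEquality
open import Algebra.Properties.CommutativeSemigroup +-commutativeSemigroup
  using () renaming (interchange to +-interchange; x∙yz≈xz∙y to +-x∙yz≈xz∙y)
open import Algebra.Properties.CommutativeSemigroup *-commutativeSemigroup
  using (x∙yz≈y∙xz; x∙yz≈yx∙z; xy∙z≈y∙zx) renaming (interchange to *-interchange)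

private
  variable
    A B : Set
    m : ℕ

-- Also applies to `if m ≤ᵇ n then x else 0`, as `does (m ≤? n)` computes to `m ≤ᵇ n`.
if-yes : ∀ {P : Set} (P? : Dec P) {x : ℕ} → P → (if does P? then x else 0) ≡ x
if-yes (yes _) _ = refl
if-yes (no ¬p) p = ⊥-elim (¬p p)

if-no : ∀ {P : Set} (P? : Dec P) {x : ℕ} → ¬ P → (if does P? then x else 0) ≡ 0
if-no (yes p) ¬p = ⊥-elim (¬p p)
if-no (no _)  _  = refl

sum-map-++ : ∀ (f : A → ℕ) xs ys → sum (List.map f (xs ++ ys)) ≡ sum (List.map f xs) + sum (List.map f ys)
sum-map-++ f xs ys = trans (cong sum (List.map-++ f xs ys)) (sum-++ (List.map f xs) (List.map f ys))

sum-map-concatMap : ∀ (f : B → ℕ) (g : A → List B) xs →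
  sum (List.map f (concatMap g xs)) ≡ sum (List.map (λ x → sum (List.map f (g x))) xs)
sum-map-concatMap f g []       = refl
sum-map-concatMap f g (x ∷ xs) =
  trans (sum-map-++ f (g x) (concatMap g xs)) (cong (sum (List.map f (g x)) +_) (sum-map-concatMap f g xs))

sum-map-∘ : ∀ (f : B → ℕ) (g : A → B) xs → sum (List.map f (List.map g xs)) ≡ sum (List.map (f ∘ g) xs)
sum-map-∘ f g xs = cong sum (sym (List.map-∘ xs))

sum-map-cong : ∀ {f g : A → ℕ} → (∀ x → f x ≡ g x) → ∀ xs → sum (List.map f xs) ≡ sum (List.map g xs)
sum-map-cong f≗g xs = cong sum (List.map-cong f≗g xs)

sum-map-*ˡ : ∀ c (f : A → ℕ) xs → sum (List.map (λ x → c * f x) xs) ≡ c * sum (List.map f xs)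
sum-map-*ˡ c f []       = sym (*-zeroʳ c)
sum-map-*ˡ c f (x ∷ xs) = trans (cong (c * f x +_) (sum-map-*ˡ c f xs)) (sym (*-distribˡ-+ c (f x) _))

sum-map-≡0 : ∀ {f : A → ℕ} → (∀ x → f x ≡ 0) → ∀ xs → sum (List.map f xs) ≡ 0
sum-map-≡0 f≡0 xs = trans (sum-map-cong f≡0 xs) (zeros xs)
  where
  zeros : ∀ (xs : List A) → sum (List.map (λ _ → 0) xs) ≡ 0
  zeros []       = refl
  zeros (_ ∷ xs) = zeros xs

sum-map-filter : ∀ {P : A → Set} (P? : Decidable P) (f : A → ℕ) xs →
  sum (List.map f (filter P? xs)) ≡ sum (List.map (λ x → if does (P? x) then f x else 0) xs)
sum-map-filter P? f []       = refl
sum-map-filter P? f (x ∷ xs) with does (P? x)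
... | true  = cong (f x +_) (sum-map-filter P? f xs)
... | false = sum-map-filter P? f xs

sumBelow : ℕ → (ℕ → ℕ) → ℕ
sumBelow zero    g = 0
sumBelow (suc n) g = g 0 + sumBelow n (g ∘ suc)

sum-map-upTo : ∀ (g : ℕ → ℕ) n → sum (List.map g (upTo n)) ≡ sumBelow n g
sum-map-upTo g n = go g (λ i → i) n
  where
  go : ∀ (g f : ℕ → ℕ) n → sum (List.map g (applyUpTo f n)) ≡ sumBelow n (g ∘ f)
  go g f zero    = refl
  go g f (suc n) = cong (g (f 0) +_) (go g (f ∘ suc) n)

sumBelow-cong : ∀ n {g h : ℕ → ℕ} → (∀ i → g i ≡ h i) → sumBelow n g ≡ sumBelow n h
sumBelow-cong zero    g≗h = refl
sumBelow-cong (suc n) g≗h = cong₂ _+_ (g≗h 0) (sumBelow-cong n (g≗h ∘ suc))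

sumBelow-+ : ∀ n (g h : ℕ → ℕ) → sumBelow n (λ i → g i + h i) ≡ sumBelow n g + sumBelow n h
sumBelow-+ zero    g h = refl
sumBelow-+ (suc n) g h =
  trans (cong (g 0 + h 0 +_) (sumBelow-+ n (g ∘ suc) (h ∘ suc))) (+-interchange (g 0) (h 0) _ _)

sumBelow-*ˡ : ∀ n c (g : ℕ → ℕ) → sumBelow n (λ i → c * g i) ≡ c * sumBelow n g
sumBelow-*ˡ zero    c g = sym (*-zeroʳ c)
sumBelow-*ˡ (suc n) c g =
  trans (cong (c * g 0 +_) (sumBelow-*ˡ n c (g ∘ suc))) (sym (*-distribˡ-+ c (g 0) _))

sumBelow-≡0 : ∀ n (g : ℕ → ℕ) → (∀ i → i < n → g i ≡ 0) → sumBelow n g ≡ 0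
sumBelow-≡0 zero    g g≡0 = refl
sumBelow-≡0 (suc n) g g≡0 =
  cong₂ _+_ (g≡0 0 (s≤s z≤n)) (sumBelow-≡0 n (g ∘ suc) (λ i i<n → g≡0 (suc i) (s≤s i<n)))

sumBelow-single : ∀ n (g : ℕ → ℕ) a → a < n → (∀ i → i < n → i ≢ a → g i ≡ 0) → sumBelow n g ≡ g a
sumBelow-single (suc n) g zero    _ g≡0 =
  trans (cong (g 0 +_) (sumBelow-≡0 n (g ∘ suc) (λ i i<n → g≡0 (suc i) (s≤s i<n) λ ()))) (+-identityʳ (g 0))
sumBelow-single (suc n) g (suc a) (s≤s a<n) g≡0 =
  cong₂ _+_ (g≡0 0 (s≤s z≤n) λ ()) (sumBelow-single n (g ∘ suc) a a<n
    (λ i i<n i≢a → g≡0 (suc i) (s≤s i<n) (i≢a ∘ suc-injective)))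

sumBelow-∷ʳ : ∀ n (g : ℕ → ℕ) → sumBelow (suc n) g ≡ sumBelow n g + g n
sumBelow-∷ʳ zero    g = +-comm (g 0) 0
sumBelow-∷ʳ (suc n) g = trans (cong (g 0 +_) (sumBelow-∷ʳ n (g ∘ suc))) (sym (+-assoc (g 0) _ _))

sumBelow-shift : ∀ n (g : ℕ → ℕ) → g 0 ≡ 0 → g n ≡ 0 → sumBelow n g ≡ sumBelow n (g ∘ suc)
sumBelow-shift zero    g _    _    = refl
sumBelow-shift (suc n) g g0≡0 gn≡0 = begin
  g 0 + sumBelow n (g ∘ suc)          ≡⟨ cong (_+ sumBelow n (g ∘ suc)) g0≡0 ⟩
  sumBelow n (g ∘ suc)                ≡⟨ sym (+-identityʳ _) ⟩
  sumBelow n (g ∘ suc) + 0            ≡⟨ cong (sumBelow n (g ∘ suc) +_) (sym gn≡0) ⟩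
  sumBelow n (g ∘ suc) + g (suc n)    ≡⟨ sym (sumBelow-∷ʳ n (g ∘ suc)) ⟩
  sumBelow (suc n) (g ∘ suc)          ∎
  where open ≡-Reasoning

nPk≡nP′k : ∀ {n k} → k ≤ n → n P k ≡ n P′ k
nPk≡nP′k {n} {k} = if-yes (k ≤? n)

nP[1+k]≡[n∸k]*nPk : ∀ n k → n P suc k ≡ (n ∸ k) * (n P k)
nP[1+k]≡[n∸k]*nPk n k with k <? n
... | yes k<n = trans (nPk≡nP′k k<n) (cong ((n ∸ k) *_) (sym (nPk≡nP′k (<⇒≤ k<n))))
... | no  k≮n = trans (k>n⇒nPk≡0 (s≤s n≤k)) (sym (cong (_* (n P k)) (m≤n⇒m∸n≡0 n≤k)))
  where
  n≤k : n ≤ k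
  n≤k = ≮⇒≥ k≮n

n*nPk≡nP[1+k]+k*nPk : ∀ n k → n * (n P k) ≡ n P suc k + k * (n P k)
n*nPk≡nP[1+k]+k*nPk n k with k ≤? n
... | yes k≤n = begin
  n * (n P k)                       ≡⟨ cong (_* (n P k)) (sym (m∸n+n≡m k≤n)) ⟩
  (n ∸ k + k) * (n P k)             ≡⟨ *-distribʳ-+ (n P k) (n ∸ k) k ⟩
  (n ∸ k) * (n P k) + k * (n P k)   ≡⟨ cong (_+ k * (n P k)) (sym (nP[1+k]≡[n∸k]*nPk n k)) ⟩
  n P suc k + k * (n P k)           ∎
  where open ≡-Reasoning
... | no  k≰n
  rewrite k>n⇒nPk≡0 (≰⇒> k≰n) | k>n⇒nPk≡0 (m<n⇒m<1+n (≰⇒> k≰n)) | *-zeroʳ n | *-zeroʳ k = refl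

m<k⇒S[m,k]≡0 : ∀ {m k} → m < k → S m k ≡ 0
m<k⇒S[m,k]≡0 {zero}  {suc k} _ = refl
m<k⇒S[m,k]≡0 {suc m} {suc k} (s≤s m<k)
  rewrite m<k⇒S[m,k]≡0 (m<n⇒m<1+n m<k) | m<k⇒S[m,k]≡0 m<k | *-zeroʳ (suc k) = refl

sumBelow-S*P≡^ : ∀ x m B → m < B → sumBelow B (λ k → S m k * (x P k)) ≡ x ^ m
sumBelow-S*P≡^ x zero    (suc B) _ = cong suc (sumBelow-≡0 B _ (λ _ _ → refl))
sumBelow-S*P≡^ x (suc m) (suc B) (s≤s m<B) = sym (begin
  x * x ^ m
    ≡⟨ cong (x *_) (sym (sumBelow-S*P≡^ x m B m<B)) ⟩
  x * sumBelow B (λ k → S m k * (x P k))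
    ≡⟨ sym (sumBelow-*ˡ B x _) ⟩
  sumBelow B (λ k → x * (S m k * (x P k)))
    ≡⟨ sumBelow-cong B split ⟩
  sumBelow B (λ k → S m k * (x P suc k) + k * S m k * (x P k))
    ≡⟨ sumBelow-+ B _ _ ⟩
  sumBelow B (λ k → S m k * (x P suc k)) + sumBelow B (λ k → k * S m k * (x P k))
    ≡⟨ cong (sumBelow B (λ k → S m k * (x P suc k)) +_) shifted ⟩
  sumBelow B (λ k → S m k * (x P suc k)) + sumBelow B (λ k → suc k * S m (suc k) * (x P suc k))
    ≡⟨ sym (sumBelow-+ B _ _) ⟩
  sumBelow B (λ k → S m k * (x P suc k) + suc k * S m (suc k) * (x P suc k))
    ≡⟨ sumBelow-cong B (λ k → sym (*-distribʳ-+ (x P suc k) (S m k) _)) ⟩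
  sumBelow B (λ k → (S m k + suc k * S m (suc k)) * (x P suc k))
    ≡⟨ sumBelow-cong B (λ k → cong (_* (x P suc k)) (+-comm (S m k) _)) ⟩
  sumBelow B (λ k → S (suc m) (suc k) * (x P suc k)) ∎)
  where
  open ≡-Reasoning
  split : ∀ k → x * (S m k * (x P k)) ≡ S m k * (x P suc k) + k * S m k * (x P k)
  split k = begin
    x * (S m k * (x P k))
      ≡⟨ x∙yz≈y∙xz x (S m k) (x P k) ⟩
    S m k * (x * (x P k))
      ≡⟨ cong (S m k *_) (n*nPk≡nP[1+k]+k*nPk x k) ⟩
    S m k * (x P suc k + k * (x P k))
      ≡⟨ *-distribˡ-+ (S m k) _ _ ⟩
    S m k * (x P suc k) + S m k * (k * (x P k))
      ≡⟨ cong (S m k * (x P suc k) +_) (x∙yz≈yx∙z (S m k) k (x P k)) ⟩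
    S m k * (x P suc k) + k * S m k * (x P k) ∎
  shifted : sumBelow B (λ k → k * S m k * (x P k)) ≡ sumBelow B (λ k → suc k * S m (suc k) * (x P suc k))
  shifted = sumBelow-shift B _ refl
    (trans (cong (λ s → B * s * (x P B)) (m<k⇒S[m,k]≡0 m<B)) (cong (_* (x P B)) (*-zeroʳ B)))

nPk*[n∸k]!≡n! : ∀ {n k} → k ≤ n → (n P k) * (n ∸ k) ! ≡ n !
nPk*[n∸k]!≡n! {n} {k} k≤n =
  trans (cong (_* (n ∸ k) !) (nPk≡n!/[n∸k]! k≤n)) (m/n*n≡m {{_}} (m≤n⇒m!∣n! (m∸n≤m n k)))

[m+n]Cn*[n!*m!]≡[m+n]! : ∀ m n → ((m + n) C n) * (n ! * m !) ≡ (m + n) !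
[m+n]Cn*[n!*m!]≡[m+n]! m n = begin
  ((m + n) C n) * (n ! * m !)            ≡⟨ cong (λ x → ((m + n) C n) * (n ! * x !)) (sym (m+n∸n≡m m n)) ⟩
  ((m + n) C n) * (n ! * (m + n ∸ n) !)  ≡⟨ cong (_* (n ! * (m + n ∸ n) !)) (nCk≡n!/k![n-k]! n≤m+n) ⟩
  _                                      ≡⟨ m/n*n≡m {{_}} (k![n∸k]!∣n! n≤m+n) ⟩
  (m + n) !                              ∎
  where
  open ≡-Reasoning
  n≤m+n : n ≤ m + n
  n≤m+n = m≤n+m n m

factProd∣vsum! : ∀ (r : Vec ℕ m) → factProd r ∣ vsum r !
factProd∣vsum! []       = ∣-refl
factProd∣vsum! (x ∷ xs) = ∣-trans (*-monoʳ-∣ (x !) (factProd∣vsum! xs))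
  (subst (λ y → x ! * y ! ∣ (x + vsum xs) !) (m+n∸m≡n x (vsum xs)) (k![n∸k]!∣n! (m≤m+n x (vsum xs))))

multinomial*factProd≡vsum! : ∀ (r : Vec ℕ m) → multinomial r * factProd r ≡ vsum r !
multinomial*factProd≡vsum! r = m/n*n≡m {{factProd≢0 r}} (factProd∣vsum! r)

infixl 6 _+ᵛ_ _∸ᵛ_
infix  4 _≤ᵛ_

_+ᵛ_ _∸ᵛ_ : Vec ℕ m → Vec ℕ m → Vec ℕ m
_+ᵛ_ = zipWith _+_
_∸ᵛ_ = zipWith _∸_

_≤ᵛ_ : Vec ℕ m → Vec ℕ m → Set
_≤ᵛ_ = Pointwise _≤_

vsum-+ᵛ : ∀ (K R : Vec ℕ m) → vsum (K +ᵛ R) ≡ vsum K + vsum R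
vsum-+ᵛ []       []       = refl
vsum-+ᵛ (k ∷ K) (r ∷ R) = trans (cong (k + r +_) (vsum-+ᵛ K R)) (+-interchange k r (vsum K) (vsum R))

vsum-mono-≤ : ∀ {K T : Vec ℕ m} → K ≤ᵛ T → vsum K ≤ vsum T
vsum-mono-≤ []         = z≤n
vsum-mono-≤ (k≤t ∷ K≤T) = +-mono-≤ k≤t (vsum-mono-≤ K≤T)

+ᵛ-∸ᵛ : ∀ {K T : Vec ℕ m} → K ≤ᵛ T → K +ᵛ (T ∸ᵛ K) ≡ T
+ᵛ-∸ᵛ []          = refl
+ᵛ-∸ᵛ (k≤t ∷ K≤T) = cong₂ _∷_ (m+[n∸m]≡n k≤t) (+ᵛ-∸ᵛ K≤T)

vsum-∸ᵛ : ∀ {K T : Vec ℕ m} → K ≤ᵛ T → vsum (T ∸ᵛ K) ≡ vsum T ∸ vsum K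
vsum-∸ᵛ {K = K} {T} K≤T = begin
  vsum (T ∸ᵛ K)                         ≡⟨ sym (m+n∸m≡n (vsum K) _) ⟩
  vsum K + vsum (T ∸ᵛ K) ∸ vsum K       ≡⟨ cong (_∸ vsum K) (sym (vsum-+ᵛ K (T ∸ᵛ K))) ⟩
  vsum (K +ᵛ (T ∸ᵛ K)) ∸ vsum K         ≡⟨ cong (λ v → vsum v ∸ vsum K) (+ᵛ-∸ᵛ K≤T) ⟩
  vsum T ∸ vsum K                       ∎
  where open ≡-Reasoning

+ᵛ≡⇒≤ᵛ : ∀ (K R : Vec ℕ m) {T} → K +ᵛ R ≡ T → K ≤ᵛ T
+ᵛ≡⇒≤ᵛ []       []       refl = []
+ᵛ≡⇒≤ᵛ (k ∷ K) (r ∷ R) refl = m≤m+n k r ∷ +ᵛ≡⇒≤ᵛ K R refl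

+ᵛ≡⇒≡∸ᵛ : ∀ (K R : Vec ℕ m) {T} → K +ᵛ R ≡ T → R ≡ T ∸ᵛ K
+ᵛ≡⇒≡∸ᵛ []       []       refl = refl
+ᵛ≡⇒≡∸ᵛ (k ∷ K) (r ∷ R) refl = cong₂ _∷_ (sym (m+n∸m≡n k r)) (+ᵛ≡⇒≡∸ᵛ K R refl)

∏P≡0 : ∀ (K T : Vec ℕ m) → ¬ K ≤ᵛ T → vprod (zipWith _P_ T K) ≡ 0
∏P≡0 []       []       K≰T = ⊥-elim (K≰T [])
∏P≡0 (k ∷ K) (t ∷ T) K≰T with k ≤? t
... | yes k≤t = trans (cong ((t P k) *_) (∏P≡0 K T (K≰T ∘ (k≤t ∷_)))) (*-zeroʳ (t P k))
... | no  k≰t = cong (_* vprod (zipWith _P_ T K)) (k>n⇒nPk≡0 (≰⇒> k≰t))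

∏P*factProd≡factProd : ∀ {K T : Vec ℕ m} → K ≤ᵛ T →
  vprod (zipWith _P_ T K) * factProd (T ∸ᵛ K) ≡ factProd T
∏P*factProd≡factProd [] = refl
∏P*factProd≡factProd {K = k ∷ K} {t ∷ T} (k≤t ∷ K≤T) = begin
  (t P k) * vprod (zipWith _P_ T K) * ((t ∸ k) ! * factProd (T ∸ᵛ K))
    ≡⟨ *-interchange (t P k) (vprod (zipWith _P_ T K)) ((t ∸ k) !) _ ⟩
  (t P k) * (t ∸ k) ! * (vprod (zipWith _P_ T K) * factProd (T ∸ᵛ K))
    ≡⟨ cong₂ _*_ (nPk*[n∸k]!≡n! k≤t) (∏P*factProd≡factProd K≤T) ⟩
  t ! * factProd T ∎
  where open ≡-Reasoning

-- The only term of ω_K contributing to x^T in t-degree |T|: the one with r = T ∸ K.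
multinomial-∸ᵛ : ∀ {K T : Vec ℕ m} → K ≤ᵛ T → let k = vsum T ∸ vsum K in
  vsum K ! * ((vsum K + k) C k) * multinomial (T ∸ᵛ K) ≡ multinomial T * vprod (zipWith _P_ T K)
multinomial-∸ᵛ {m = m} {K = K} {T} K≤T =
  *-cancelʳ-≡ _ _ (factProd R) {{factProd≢0 R}} (trans lhs (sym rhs))
  where
  open ≡-Reasoning
  R : Vec ℕ m
  R = T ∸ᵛ K
  k : ℕ
  k = vsum T ∸ vsum K
  lhs : vsum K ! * ((vsum K + k) C k) * multinomial R * factProd R ≡ vsum T !
  lhs = begin
    vsum K ! * ((vsum K + k) C k) * multinomial R * factProd R
      ≡⟨ *-assoc (vsum K ! * ((vsum K + k) C k)) _ _ ⟩
    vsum K ! * ((vsum K + k) C k) * (multinomial R * factProd R)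
      ≡⟨ cong (vsum K ! * ((vsum K + k) C k) *_)
              (trans (multinomial*factProd≡vsum! R) (cong _! (vsum-∸ᵛ K≤T))) ⟩
    vsum K ! * ((vsum K + k) C k) * k !
      ≡⟨ xy∙z≈y∙zx (vsum K !) ((vsum K + k) C k) (k !) ⟩
    ((vsum K + k) C k) * (k ! * vsum K !)
      ≡⟨ [m+n]Cn*[n!*m!]≡[m+n]! (vsum K) k ⟩
    (vsum K + k) !
      ≡⟨ cong _! (m+[n∸m]≡n (vsum-mono-≤ K≤T)) ⟩
    vsum T ! ∎
  rhs : multinomial T * vprod (zipWith _P_ T K) * factProd R ≡ vsum T !
  rhs = begin
    multinomial T * vprod (zipWith _P_ T K) * factProd R
      ≡⟨ *-assoc (multinomial T) _ _ ⟩
    multinomial T * (vprod (zipWith _P_ T K) * factProd R)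
      ≡⟨ cong (multinomial T *_) (∏P*factProd≡factProd K≤T) ⟩
    multinomial T * factProd T
      ≡⟨ multinomial*factProd≡vsum! T ⟩
    vsum T ! ∎

sum-box-∏S*∏P≡∏^ : ∀ (U T : Vec ℕ m) →
  sum (List.map (λ K → vprod (zipWith S U K) * vprod (zipWith _P_ T K)) (box U)) ≡ vprod (zipWith _^_ T U)
sum-box-∏S*∏P≡∏^ []       []       = refl
sum-box-∏S*∏P≡∏^ (u ∷ U) (t ∷ T) = begin
  sum (List.map F (box (u ∷ U)))
    ≡⟨ sum-map-concatMap F (λ i → List.map (i ∷_) (box U)) (upTo (suc u)) ⟩
  sum (List.map (λ i → sum (List.map F (List.map (i ∷_) (box U)))) (upTo (suc u)))
    ≡⟨ sum-map-upTo _ (suc u) ⟩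
  sumBelow (suc u) (λ i → sum (List.map F (List.map (i ∷_) (box U))))
    ≡⟨ sumBelow-cong (suc u) fibre ⟩
  sumBelow (suc u) (λ i → rest * (S u i * (t P i)))
    ≡⟨ sumBelow-*ˡ (suc u) rest (λ i → S u i * (t P i)) ⟩
  rest * sumBelow (suc u) (λ i → S u i * (t P i))
    ≡⟨ cong₂ _*_ (sum-box-∏S*∏P≡∏^ U T) (sumBelow-S*P≡^ t u (suc u) ≤-refl) ⟩
  vprod (zipWith _^_ T U) * t ^ u
    ≡⟨ *-comm _ (t ^ u) ⟩
  t ^ u * vprod (zipWith _^_ T U) ∎
  where
  open ≡-Reasoning
  G : Vec ℕ _ → ℕ
  G K = vprod (zipWith S U K) * vprod (zipWith _P_ T K)
  F : Vec ℕ _ → ℕ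
  F K = vprod (zipWith S (u ∷ U) K) * vprod (zipWith _P_ (t ∷ T) K)
  rest : ℕ
  rest = sum (List.map G (box U))
  fibre : ∀ i → sum (List.map F (List.map (i ∷_) (box U))) ≡ rest * (S u i * (t P i))
  fibre i = begin
    sum (List.map F (List.map (i ∷_) (box U)))
      ≡⟨ sum-map-∘ F (i ∷_) (box U) ⟩
    sum (List.map (λ K → F (i ∷ K)) (box U))
      ≡⟨ sum-map-cong (λ K → *-interchange (S u i) _ (t P i) _) (box U) ⟩
    sum (List.map (λ K → S u i * (t P i) * G K) (box U))
      ≡⟨ sum-map-*ˡ (S u i * (t P i)) G (box U) ⟩
    S u i * (t P i) * rest
      ≡⟨ *-comm _ rest ⟩
    rest * (S u i * (t P i)) ∎

sum-compositions-suc : ∀ m k (φ : Vec ℕ (suc m) → ℕ) →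
  sum (List.map φ (compositions (suc m) k))
    ≡ sumBelow (suc k) (λ i → sum (List.map (φ ∘ (i ∷_)) (compositions m (k ∸ i))))
sum-compositions-suc m k φ = begin
  sum (List.map φ (compositions (suc m) k))
    ≡⟨ sum-map-concatMap φ (λ i → List.map (i ∷_) (compositions m (k ∸ i))) (upTo (suc k)) ⟩
  sum (List.map (λ i → sum (List.map φ (List.map (i ∷_) (compositions m (k ∸ i))))) (upTo (suc k)))
    ≡⟨ sum-map-upTo _ (suc k) ⟩
  sumBelow (suc k) (λ i → sum (List.map φ (List.map (i ∷_) (compositions m (k ∸ i)))))
    ≡⟨ sumBelow-cong (suc k) (λ i → sum-map-∘ φ (i ∷_) (compositions m (k ∸ i))) ⟩
  sumBelow (suc k) (λ i → sum (List.map (φ ∘ (i ∷_)) (compositions m (k ∸ i)))) ∎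
  where open ≡-Reasoning

sum-compositions-≡0 : ∀ m k (φ : Vec ℕ m → ℕ) → (∀ r → vsum r ≡ k → φ r ≡ 0) →
  sum (List.map φ (compositions m k)) ≡ 0
sum-compositions-≡0 zero    zero    φ φ≡0 = trans (+-identityʳ (φ [])) (φ≡0 [] refl)
sum-compositions-≡0 zero    (suc k) φ φ≡0 = refl
sum-compositions-≡0 (suc m) k       φ φ≡0 = trans (sum-compositions-suc m k φ)
  (sumBelow-≡0 (suc k) _ λ i i<1+k → sum-compositions-≡0 m (k ∸ i) (φ ∘ (i ∷_))
    λ r vsum-r → φ≡0 (i ∷ r) (trans (cong (i +_) vsum-r) (m+[n∸m]≡n (≤-pred i<1+k))))

sum-compositions-single : ∀ m k (φ : Vec ℕ m → ℕ) (R : Vec ℕ m) → vsum R ≡ k →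
  (∀ r → vsum r ≡ k → r ≢ R → φ r ≡ 0) → sum (List.map φ (compositions m k)) ≡ φ R
sum-compositions-single zero    _ φ []       refl φ≡0 = +-identityʳ (φ [])
sum-compositions-single (suc m) _ φ (i ∷ R) refl φ≡0 = trans (sum-compositions-suc m k φ)
  (trans (sumBelow-single (suc k) _ i (s≤s (m≤m+n i (vsum R)))
           λ j j<1+k j≢i → sum-compositions-≡0 m (k ∸ j) (φ ∘ (j ∷_))
             λ r vsum-r → φ≡0 (j ∷ r) (trans (cong (j +_) vsum-r) (m+[n∸m]≡n (≤-pred j<1+k)))
                                      (j≢i ∘ Vec.∷-injectiveˡ))
         (sum-compositions-single m (k ∸ i) (φ ∘ (i ∷_)) R (sym (m+n∸m≡n i (vsum R)))
           λ r vsum-r r≢R → φ≡0 (i ∷ r) (trans (cong (i +_) vsum-r) (m+[n∸m]≡n (m≤m+n i (vsum R))))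
                                        (r≢R ∘ Vec.∷-injectiveʳ)))
  where
  k : ℕ
  k = i + vsum R

m-n≡o-p⇒m+p≡o+n : ∀ m n o p → ℤ.+ m ℤ.- ℤ.+ n ≡ ℤ.+ o ℤ.- ℤ.+ p → m + p ≡ o + n
m-n≡o-p⇒m+p≡o+n m n o p eq = ℤ.+-injective (begin
  ℤ.+ (m + p)                                        ≡⟨ ℤ.pos-+ m p ⟩
  ℤ.+ m ℤ.+ ℤ.+ p                                    ≡⟨ regroup (ℤ.+ m) (ℤ.+ n) (ℤ.+ p) ⟩
  (ℤ.+ m ℤ.- ℤ.+ n) ℤ.+ (ℤ.+ n ℤ.+ ℤ.+ p)            ≡⟨ cong (ℤ._+ (ℤ.+ n ℤ.+ ℤ.+ p)) eq ⟩
  (ℤ.+ o ℤ.- ℤ.+ p) ℤ.+ (ℤ.+ n ℤ.+ ℤ.+ p)            ≡⟨ regroup′ (ℤ.+ o) (ℤ.+ n) (ℤ.+ p) ⟩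
  ℤ.+ o ℤ.+ ℤ.+ n                                    ≡⟨ sym (ℤ.pos-+ o n) ⟩
  ℤ.+ (o + n)                                        ∎)
  where
  open ≡-Reasoning
  regroup : ∀ (x y z : ℤ) → x ℤ.+ z ≡ (x ℤ.- y) ℤ.+ (y ℤ.+ z)
  regroup = ℤ.solve-∀
  regroup′ : ∀ (x y z : ℤ) → (x ℤ.- z) ℤ.+ (y ℤ.+ z) ≡ x ℤ.+ y
  regroup′ = ℤ.solve-∀

laurent-≡⇒≡map-+ : ∀ {n} {a b : Vec ℕ (suc n)} → laurent a ≡ laurent b → head b ≤ head a →
  a ≡ Vec.map (_+ (head a ∸ head b)) b
laurent-≡⇒≡map-+ {a = a₀ ∷ as} {b₀ ∷ bs} eq b₀≤a₀ = cong₂ _∷_ (sym b₀+d≡a₀) (tails as bs eq)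
  where
  d : ℕ
  d = a₀ ∸ b₀
  b₀+d≡a₀ : b₀ + d ≡ a₀
  b₀+d≡a₀ = m+[n∸m]≡n b₀≤a₀
  entry : ∀ x y → ℤ.+ x ℤ.- ℤ.+ a₀ ≡ ℤ.+ y ℤ.- ℤ.+ b₀ → x ≡ y + d
  entry x y e = +-cancelʳ-≡ b₀ x (y + d) (begin
    x + b₀          ≡⟨ m-n≡o-p⇒m+p≡o+n x a₀ y b₀ e ⟩
    y + a₀          ≡⟨ cong (y +_) (sym b₀+d≡a₀) ⟩
    y + (b₀ + d)    ≡⟨ +-x∙yz≈xz∙y y b₀ d ⟩
    y + d + b₀      ∎)
    where open ≡-Reasoning
  tails : ∀ {m} (as bs : Vec ℕ m) →
    Vec.map (λ e → ℤ.+ e ℤ.- ℤ.+ a₀) as ≡ Vec.map (λ e → ℤ.+ e ℤ.- ℤ.+ b₀) bs → as ≡ Vec.map (_+ d) bs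
  tails []       []       _  = refl
  tails (x ∷ as) (y ∷ bs) eq = cong₂ _∷_ (entry x y (Vec.∷-injectiveˡ eq)) (tails as bs (Vec.∷-injectiveʳ eq))

vsum-map-+ : ∀ d (b : Vec ℕ m) → vsum (Vec.map (_+ d) b) ≡ vsum b + m * d
vsum-map-+ d []      = refl
vsum-map-+ d (x ∷ b) = trans (cong (x + d +_) (vsum-map-+ d b)) (+-interchange x d (vsum b) _)

Any≡0-map-+⇒≡0 : ∀ d {b : Vec ℕ m} → Any (_≡ 0) (Vec.map (_+ d) b) → d ≡ 0
Any≡0-map-+⇒≡0 d {x ∷ b} (here x+d≡0) = m+n≡0⇒n≡0 x x+d≡0
Any≡0-map-+⇒≡0 d {x ∷ b} (there p)    = Any≡0-map-+⇒≡0 d p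

-- Equal Laurent monomials have exponent vectors differing by a multiple of (1,…,1);
-- a zero entry of b keeps a from lying strictly below b, the degree bound from lying above.
laurent-≡⇒≡ : ∀ {n} {a b : Vec ℕ (suc n)} → laurent a ≡ laurent b → Any (_≡ 0) b → vsum a ≤ vsum b → a ≡ b
laurent-≡⇒≡ {n} {a} {b} eq b-min a≤b with head b ≤? head a
... | yes b₀≤a₀ = trans a≡b+d (trans (cong (λ e → Vec.map (_+ e) b) d≡0) b+0≡b)
  where
  d : ℕ
  d = head a ∸ head b
  a≡b+d : a ≡ Vec.map (_+ d) b
  a≡b+d = laurent-≡⇒≡map-+ eq b₀≤a₀
  b+nd≤b+0 : vsum b + suc n * d ≤ vsum b + 0
  b+nd≤b+0 = subst₂ _≤_ (trans (cong vsum a≡b+d) (vsum-map-+ d b)) (sym (+-identityʳ (vsum b))) a≤b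
  d≡0 : d ≡ 0
  d≡0 = m+n≡0⇒m≡0 d (n≤0⇒n≡0 (+-cancelˡ-≤ (vsum b) _ _ b+nd≤b+0))
  b+0≡b : Vec.map (_+ 0) b ≡ b
  b+0≡b = trans (Vec.map-cong +-identityʳ b) (Vec.map-id b)
... | no b₀≰a₀ = ⊥-elim (<-irrefl (sym e≡0) (m<n⇒0<n∸m a₀<b₀))
  where
  a₀<b₀ : head a < head b
  a₀<b₀ = ≰⇒> b₀≰a₀
  e : ℕ
  e = head b ∸ head a
  b≡a+e : b ≡ Vec.map (_+ e) a
  b≡a+e = laurent-≡⇒≡map-+ (sym eq) (<⇒≤ a₀<b₀)
  e≡0 : e ≡ 0
  e≡0 = Any≡0-map-+⇒≡0 e (subst (Any (_≡ 0)) b≡a+e b-min)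

module _ {n} (T : Vec ℕ (suc n)) (T-min : Any (_≡ 0) T) (K : Vec ℕ (suc n)) where

  private
    hits? : (r : Vec ℕ (suc n)) → Dec (laurent (K +ᵛ r) ≡ laurent T)
    hits? r = laurent (K +ᵛ r) ≟ᴸ laurent T

    term : ℕ → Vec ℕ (suc n) → ℕ
    term j r = vsum K ! * ((vsum K + (j ∸ vsum K)) C (j ∸ vsum K)) * multinomial r

    omegaCoeff≡sum : ∀ {j} → vsum K ≤ j → omegaCoeff K (laurent T) j
      ≡ sum (List.map (λ r → if does (hits? r) then term j r else 0) (compositions (suc n) (j ∸ vsum K)))
    omegaCoeff≡sum {j} K≤j =
      trans (if-yes (vsum K ≤? j) K≤j) (sum-map-filter hits? (term j) (compositions (suc n) (j ∸ vsum K)))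

    vsum-K+r : ∀ {j} r → vsum K ≤ j → vsum r ≡ j ∸ vsum K → vsum (K +ᵛ r) ≡ j
    vsum-K+r r K≤j vsum-r = trans (vsum-+ᵛ K r) (trans (cong (vsum K +_) vsum-r) (m+[n∸m]≡n K≤j))

    hit⇒≡T : ∀ {j} r → vsum K ≤ j → j ≤ vsum T → vsum r ≡ j ∸ vsum K →
      laurent (K +ᵛ r) ≡ laurent T → K +ᵛ r ≡ T
    hit⇒≡T r K≤j j≤T vsum-r hit = laurent-≡⇒≡ hit T-min (≤-trans (≤-reflexive (vsum-K+r r K≤j vsum-r)) j≤T)

    omegaCoeff-≡0 : ∀ {j} → j ≤ vsum T → (∀ r → vsum (K +ᵛ r) ≡ j → K +ᵛ r ≢ T) →
      omegaCoeff K (laurent T) j ≡ 0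
    omegaCoeff-≡0 {j} j≤T ¬split with vsum K ≤? j
    ... | no  K≰j = if-no (vsum K ≤? j) K≰j
    ... | yes K≤j = trans (omegaCoeff≡sum K≤j) (sum-compositions-≡0 _ _ _ λ r vsum-r →
      if-no (hits? r) λ hit → ¬split r (vsum-K+r r K≤j vsum-r) (hit⇒≡T r K≤j j≤T vsum-r hit))

  omegaCoeff-below : ∀ {j} → j < vsum T → omegaCoeff K (laurent T) j ≡ 0
  omegaCoeff-below j<T = omegaCoeff-≡0 (<⇒≤ j<T) λ r vsum≡j K+r≡T →
    <-irrefl (trans (sym vsum≡j) (cong vsum K+r≡T)) j<T

  omegaCoeff-at : omegaCoeff K (laurent T) (vsum T) ≡ multinomial T * vprod (zipWith _P_ T K)
  omegaCoeff-at with Pointwise.decidable _≤?_ K T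
  ... | no K≰T = trans (omegaCoeff-≡0 ≤-refl λ r _ K+r≡T → K≰T (+ᵛ≡⇒≤ᵛ K r K+r≡T))
                       (sym (trans (cong (multinomial T *_) (∏P≡0 K T K≰T)) (*-zeroʳ (multinomial T))))
  ... | yes K≤T = begin
    omegaCoeff K (laurent T) (vsum T)
      ≡⟨ omegaCoeff≡sum K≤∑T ⟩
    sum (List.map (λ r → if does (hits? r) then term (vsum T) r else 0) (compositions (suc n) (vsum T ∸ vsum K)))
      ≡⟨ sum-compositions-single _ _ _ (T ∸ᵛ K) (vsum-∸ᵛ K≤T) (λ r vsum-r r≢T-K →
           if-no (hits? r) λ hit → r≢T-K (+ᵛ≡⇒≡∸ᵛ K r (hit⇒≡T r K≤∑T ≤-refl vsum-r hit))) ⟩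
    (if does (hits? (T ∸ᵛ K)) then term (vsum T) (T ∸ᵛ K) else 0)
      ≡⟨ if-yes (hits? (T ∸ᵛ K)) (cong laurent (+ᵛ-∸ᵛ K≤T)) ⟩
    term (vsum T) (T ∸ᵛ K)
      ≡⟨ multinomial-∸ᵛ K≤T ⟩
    multinomial T * vprod (zipWith _P_ T K) ∎
    where
    open ≡-Reasoning
    K≤∑T : vsum K ≤ vsum T
    K≤∑T = vsum-mono-≤ K≤T

module _ {n} (U T : Vec ℕ (suc n)) (T-min : Any (_≡ 0) T) where

  etaCoeff-below : ∀ {j} → j < vsum T → etaCoeff U (laurent T) j ≡ 0
  etaCoeff-below j<T = sum-map-≡0 (λ K → trans (cong (vprod (zipWith S U K) *_) (omegaCoeff-below T T-min K j<T))
                                                (*-zeroʳ (vprod (zipWith S U K))))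
                                 (box U)

  etaCoeff-at : etaCoeff U (laurent T) (vsum T) ≡ multinomial T * vprod (zipWith _^_ T U)
  etaCoeff-at = begin
    sum (List.map (λ K → vprod (zipWith S U K) * omegaCoeff K (laurent T) (vsum T)) (box U))
      ≡⟨ sum-map-cong (λ K → trans (cong (vprod (zipWith S U K) *_) (omegaCoeff-at T T-min K))
                                   (x∙yz≈y∙xz (vprod (zipWith S U K)) (multinomial T) _)) (box U) ⟩
    sum (List.map (λ K → multinomial T * (vprod (zipWith S U K) * vprod (zipWith _P_ T K))) (box U))
      ≡⟨ sum-map-*ˡ (multinomial T) _ (box U) ⟩
    multinomial T * sum (List.map (λ K → vprod (zipWith S U K) * vprod (zipWith _P_ T K)) (box U))
      ≡⟨ cong (multinomial T *_) (sum-box-∏S*∏P≡∏^ U T) ⟩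
    multinomial T * vprod (zipWith _^_ T U) ∎
    where open ≡-Reasoning

vsum-map-*ˡ : ∀ c (v : Vec ℕ m) → vsum (Vec.map (c *_) v) ≡ c * vsum v
vsum-map-*ˡ c []      = sym (*-zeroʳ c)
vsum-map-*ˡ c (x ∷ v) = trans (cong (c * x +_) (vsum-map-*ˡ c v)) (sym (*-distribˡ-+ c x (vsum v)))

lemma3p5 : (n : ℕ) → 1 ≤ n → (U : Vec ℕ (suc n)) → vsum U < n →
    (V : Vec ℕ (suc n)) → Any (_≡ 0) V →
    Σ ℕ (λ N₀ → (N : ℕ) → 1 ≤ N → N₀ ≤ N →
      ((j : ℕ) → j < N * vsum V →
         etaCoeff U (laurent (Vec.map (N *_) V)) j ≡ 0)
      × (etaCoeff U (laurent (Vec.map (N *_) V)) (N * vsum V)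
         ≡ multinomial (Vec.map (N *_) V)
           * vprod (zipWith (λ v u → (N * v) ^ u) V U)))
lemma3p5 n _ U _ V V-min = 0 , λ N _ _ →
    (λ j j<NV → etaCoeff-below U (T N) (T-min N) (subst (j <_) (sym (vsum-map-*ˡ N V)) j<NV))
  , (begin
      etaCoeff U (laurent (T N)) (N * vsum V)      ≡⟨ cong (etaCoeff U (laurent (T N))) (sym (vsum-map-*ˡ N V)) ⟩
      etaCoeff U (laurent (T N)) (vsum (T N))      ≡⟨ etaCoeff-at U (T N) (T-min N) ⟩
      multinomial (T N) * vprod (zipWith _^_ (T N) U)
        ≡⟨ cong (λ w → multinomial (T N) * vprod w) (Vec.zipWith-map₁ _^_ (N *_) V U) ⟩
      multinomial (T N) * vprod (zipWith (λ v u → (N * v) ^ u) V U) ∎)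
  where
  open ≡-Reasoning
  T : ℕ → Vec ℕ (suc n)
  T N = Vec.map (N *_) V
  T-min : ∀ N → Any (_≡ 0) (T N)
  T-min N = map⁺ (Any.map (λ { refl → *-zeroʳ N }) V-min)
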